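{- Let $N\geq 12$ and $1\le\Delta\leq\frac N2$ be integers. Then $f(N,\Delta)\leq\frac{N^2}{3}$.
   Context: All graphs are finite and simple; $L(G)$ is the line graph, so $e(L(G))=\sum_v\binom{\deg(v)}{2}$. For integers $N\ge\Delta\ge1$, $f(N,\Delta)=\max\{e(L(G)) : e(G)=N,\ \Delta(G)=\Delta,\ \delta(G)\geq1\}$. -}

module Defs where

open import Data.Nat using (ℕ; zero; suc; _+_; _*_; _≤_; _<_)
open import Data.Nat.Combinatorics using (_C_)
open import Data.Fin using (Fin; toℕ)
open import Data.Bool using (Bool; true; false)
open import Data.Vec.Functional using (foldr)
open import Relation.Binary.PropositionalEquality using (_≡_)
open import Data.Product using (_×_; Σ)

record Graph (n : ℕ) : Set where
  field
    adj     : Fin n → Fin n → Bool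
    symm    : ∀ i j → adj i j ≡ adj j i
    irrefl  : ∀ i → adj i i ≡ false

open Graph public

Σfin : ∀ {n} → (Fin n → ℕ) → ℕ
Σfin {n} f = foldr _+_ 0 f

b2n : Bool → ℕ
b2n true  = 1
b2n false = 0

degree : ∀ {n} → Graph n → Fin n → ℕ
degree G v = Σfin (λ w → b2n (adj G v w))

edgeCount : ∀ {n} → Graph n → ℕ
edgeCount G = Σfin (λ i → Σfin (λ j → ind i j))
  where
  open import Data.Nat using (_<ᵇ_)
  open import Data.Bool using (_∧_)
  ind : _ → _ → ℕ
  ind i j = b2n ((toℕ i <ᵇ toℕ j) ∧ adj G i j)

lineGraphEdges : ∀ {n} → Graph n → ℕ
lineGraphEdges G = Σfin (λ v → degree G v C 2)

MaxDegreeIs : ∀ {n} → Graph n → ℕ → Set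
MaxDegreeIs {n} G Δ = (∀ v → degree G v ≤ Δ) × Σ (Fin n) (λ v → degree G v ≡ Δ)

MinDegreeAtLeast1 : ∀ {n} → Graph n → Set
MinDegreeAtLeast1 G = ∀ v → 1 ≤ degree G v

{-# OPTIONS --safe #-}

-- Write d v for the degrees, so that 2 e(L(G)) + 2 N = Σ d v².  Three distinct vertices
-- have degree sum at most N + 3, because at most three edges join two of them.  Let a have
-- degree Δ and b the largest degree β among the other vertices: every remaining vertex then
-- has degree at most m = min β (N + 3 − Δ − β), so Σ d v² ≤ m · 2N + (Δ − m) Δ + (β − m) β,
-- and under 2Δ ≤ N three times this is at most 2N (N + 3).

module Submission where

open import Defs
open import Data.Nat
open import Data.Nat.Properties
open import Data.Nat.Combinatorics using (_C_; nC1≡n; nCk+nC[k+1]≡[n+1]C[k+1])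
open import Data.Nat.Tactic.RingSolver using (solve-∀)
open import Data.Fin using (Fin; zero; suc; toℕ; punchIn; punchOut)
open import Data.Fin.Properties using (toℕ-injective; punchInᵢ≢i; punchIn-punchOut)
  renaming (_≟_ to _≟ᶠ_)
open import Data.Bool using (true; false; _∧_)
open import Data.Product using (∃-syntax; _,_; _×_; proj₁; proj₂)
open import Function using (_∘_)
open import Relation.Nullary using (does; yes; no; contradiction)
open import Relation.Nullary.Decidable using (dec-true; dec-false)
open import Relation.Nullary.Reflects using (ofʸ; ofⁿ)
open import Relation.Binary.PropositionalEquality
open import Algebra.Properties.Semiring.Sum +-*-semiring
  using (sum; sum-cong-≗; sum-replicate-zero; ∑-distrib-+; ∑-comm; *-distribˡ-sum; *-distribʳ-sum)

sum-mono-≤ : ∀ {n} {f g : Fin n → ℕ} → (∀ i → f i ≤ g i) → sum f ≤ sum g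
sum-mono-≤ {zero}  f≤g = z≤n
sum-mono-≤ {suc n} f≤g = +-mono-≤ (f≤g zero) (sum-mono-≤ (f≤g ∘ suc))

sum₂ : ∀ {m n} → (Fin m → Fin n → ℕ) → ℕ
sum₂ f = sum (λ i → sum (f i))

sum₂-cong : ∀ {m n} {f g : Fin m → Fin n → ℕ} → (∀ i j → f i j ≡ g i j) → sum₂ f ≡ sum₂ g
sum₂-cong f≡g = sum-cong-≗ (λ i → sum-cong-≗ (f≡g i))

sum₂-mono-≤ : ∀ {m n} {f g : Fin m → Fin n → ℕ} → (∀ i j → f i j ≤ g i j) → sum₂ f ≤ sum₂ g
sum₂-mono-≤ f≤g = sum-mono-≤ (λ i → sum-mono-≤ (f≤g i))

sum₂-distrib-+ : ∀ {m n} (f g : Fin m → Fin n → ℕ) →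
                 sum₂ (λ i j → f i j + g i j) ≡ sum₂ f + sum₂ g
sum₂-distrib-+ f g = trans (sum-cong-≗ (λ i → ∑-distrib-+ (f i) (g i)))
                           (∑-distrib-+ (λ i → sum (f i)) (λ i → sum (g i)))

sum₂-transpose : ∀ {n} (f : Fin n → Fin n → ℕ) → sum₂ (λ i j → f j i) ≡ sum₂ f
sum₂-transpose f = ∑-comm (λ i j → f j i)

sum-*-sum : ∀ {m n} (f : Fin m → ℕ) (g : Fin n → ℕ) →
            sum f * sum g ≡ sum (λ i → sum (λ j → f i * g j))
sum-*-sum f g = trans (*-distribʳ-sum (sum g) f)
                      (sum-cong-≗ (λ i → *-distribˡ-sum (f i) g))

δ : ∀ {n} → Fin n → Fin n → ℕ
δ i j = b2n (does (i ≟ᶠ j))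

δ-refl : ∀ {n} (i : Fin n) → δ i i ≡ 1
δ-refl i = cong b2n (dec-true (i ≟ᶠ i) refl)

δ-≢ : ∀ {n} {i j : Fin n} → i ≢ j → δ i j ≡ 0
δ-≢ {i = i} {j} i≢j = cong b2n (dec-false (i ≟ᶠ j) i≢j)

sum-δ : ∀ {n} (i : Fin n) (f : Fin n → ℕ) → sum (λ j → δ i j * f j) ≡ f i
sum-δ {suc n} zero    f = trans (cong (f zero + 0 +_) (sum-replicate-zero n)) (trans (+-identityʳ _) (+-identityʳ _))
sum-δ {suc n} (suc i) f = sum-δ i (f ∘ suc)

sum-+-* : ∀ {n} (g h f : Fin n → ℕ) →
          sum (λ i → (g i + h i) * f i) ≡ sum (λ i → g i * f i) + sum (λ i → h i * f i)
sum-+-* g h f = trans (sum-cong-≗ (λ i → *-distribʳ-+ (f i) (g i) (h i)))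
                      (∑-distrib-+ (λ i → g i * f i) (λ i → h i * f i))

sum-δ₃ : ∀ {n} (a b c : Fin n) (f : Fin n → ℕ) →
         sum (λ i → (δ a i + δ b i + δ c i) * f i) ≡ f a + f b + f c
sum-δ₃ a b c f = trans (sum-+-* (λ i → δ a i + δ b i) (δ c) f)
  (cong₂ _+_ (trans (sum-+-* (δ a) (δ b) f) (cong₂ _+_ (sum-δ a f) (sum-δ b f))) (sum-δ c f))

δ+δ+δ≤1 : ∀ {n} {a b c : Fin n} → a ≢ b → a ≢ c → b ≢ c → ∀ i → δ a i + δ b i + δ c i ≤ 1
δ+δ+δ≤1 {a = a} {b} {c} a≢b a≢c b≢c i with a ≟ᶠ i | b ≟ᶠ i | c ≟ᶠ i
... | yes refl | yes refl | _        = contradiction refl a≢b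
... | yes refl | _        | yes refl = contradiction refl a≢c
... | _        | yes refl | yes refl = contradiction refl b≢c
... | yes _    | no _     | no _     = ≤-refl
... | no _     | yes _    | no _     = ≤-refl
... | no _     | no _     | yes _    = ≤-refl
... | no _     | no _     | no _     = z≤n

before : ∀ {n} → Fin n → Fin n → ℕ
before i j = b2n (toℕ i <ᵇ toℕ j)

before-trichotomy : ∀ {n} (i j : Fin n) → before i j + before j i + δ i j ≡ 1
before-trichotomy i j
  with toℕ i <ᵇ toℕ j | <ᵇ-reflects-< (toℕ i) (toℕ j)
     | toℕ j <ᵇ toℕ i | <ᵇ-reflects-< (toℕ j) (toℕ i)
... | true  | ofʸ i<j  | true  | ofʸ j<i  = contradiction j<i (<-asym i<j)
... | true  | ofʸ i<j  | false | _        = cong suc (δ-≢ (λ i≡j → <-irrefl (cong toℕ i≡j) i<j))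
... | false | _        | true  | ofʸ j<i  = cong suc (δ-≢ (λ i≡j → <-irrefl (cong toℕ (sym i≡j)) j<i))
... | false | ofⁿ i≮j | false | ofⁿ j≮i =
  subst (λ k → δ i k ≡ 1) (toℕ-injective (≤-antisym (≮⇒≥ j≮i) (≮⇒≥ i≮j))) (δ-refl i)

pairSum : ∀ {n} → (Fin n → ℕ) → ℕ
pairSum s = sum₂ (λ i j → before i j * (s i * s j))

square-of-sum : ∀ {n} (s : Fin n → ℕ) → sum s * sum s ≡ 2 * pairSum s + sum (λ i → s i * s i)
square-of-sum s = begin
  sum s * sum s
    ≡⟨ sum-*-sum s s ⟩
  sum₂ (λ i j → s i * s j)
    ≡⟨ sum₂-cong (λ i j → trans (sym (*-identityˡ _)) (cong (_* (s i * s j)) (sym (before-trichotomy i j)))) ⟩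
  sum₂ (λ i j → (before i j + before j i + δ i j) * (s i * s j))
    ≡⟨ sum₂-cong (λ i j → distrib (before i j) (before j i) (δ i j) (s i * s j)) ⟩
  sum₂ (λ i j → before i j * (s i * s j) + before j i * (s i * s j) + δ i j * (s i * s j))
    ≡⟨ sum₂-distrib-+ (λ i j → before i j * (s i * s j) + before j i * (s i * s j)) (λ i j → δ i j * (s i * s j)) ⟩
  sum₂ (λ i j → before i j * (s i * s j) + before j i * (s i * s j)) + sum₂ (λ i j → δ i j * (s i * s j))
    ≡⟨ cong₂ _+_ (sum₂-distrib-+ (λ i j → before i j * (s i * s j)) (λ i j → before j i * (s i * s j)))
                 (sum-cong-≗ (λ i → sum-δ i (λ j → s i * s j))) ⟩
  pairSum s + sum₂ (λ i j → before j i * (s i * s j)) + sum (λ i → s i * s i)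
    ≡⟨ cong (λ p → pairSum s + p + squares) (trans (sum₂-transpose (λ i j → before i j * (s j * s i))) (sum₂-cong (λ i j → cong (before i j *_) (*-comm (s j) (s i))))) ⟩
  pairSum s + pairSum s + sum (λ i → s i * s i)
    ≡⟨ cong (λ p → pairSum s + p + squares) (sym (+-identityʳ (pairSum s))) ⟩
  2 * pairSum s + sum (λ i → s i * s i) ∎
  where
  open ≡-Reasoning
  squares : ℕ
  squares = sum (λ i → s i * s i)
  distrib : ∀ p q r x → (p + q + r) * x ≡ p * x + q * x + r * x
  distrib = solve-∀

2*nC2+n≡n*n : ∀ n → 2 * (n C 2) + n ≡ n * n
2*nC2+n≡n*n zero    = refl
2*nC2+n≡n*n (suc n) = begin
  2 * (suc n C 2) + suc n      ≡⟨ cong (λ c → 2 * c + suc n) (sym (nCk+nC[k+1]≡[n+1]C[k+1] n 1)) ⟩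
  2 * (n C 1 + n C 2) + suc n  ≡⟨ cong (λ c → 2 * (c + n C 2) + suc n) (nC1≡n n) ⟩
  2 * (n + n C 2) + suc n      ≡⟨ shift n (n C 2) ⟩
  2 * (n C 2) + n + (2 * n + 1) ≡⟨ cong (_+ (2 * n + 1)) (2*nC2+n≡n*n n) ⟩
  n * n + (2 * n + 1)          ≡⟨ expand n ⟩
  suc n * suc n                ∎
  where
  open ≡-Reasoning
  shift : ∀ n c → 2 * (n + c) + suc n ≡ 2 * c + n + (2 * n + 1)
  shift = solve-∀
  expand : ∀ n → n * n + (2 * n + 1) ≡ suc n * suc n
  expand = solve-∀

bit*bit≡bit : ∀ {s} → s ≤ 1 → s * s ≡ s
bit*bit≡bit z≤n       = refl
bit*bit≡bit (s≤s z≤n) = refl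

bit+bit≤1+bit*bit : ∀ {s t} → s ≤ 1 → t ≤ 1 → s + t ≤ 1 + s * t
bit+bit≤1+bit*bit z≤n       z≤n       = z≤n
bit+bit≤1+bit*bit z≤n       (s≤s z≤n) = ≤-refl
bit+bit≤1+bit*bit (s≤s z≤n) z≤n       = ≤-refl
bit+bit≤1+bit*bit (s≤s z≤n) (s≤s z≤n) = ≤-refl

pairSum-bits : ∀ {n} (s : Fin n → ℕ) → (∀ i → s i ≤ 1) → pairSum s ≡ sum s C 2
pairSum-bits s s≤1 = *-cancelˡ-≡ (pairSum s) (sum s C 2) 2 (+-cancelʳ-≡ (sum s) (2 * pairSum s) (2 * (sum s C 2)) (begin
  2 * pairSum s + sum s                  ≡⟨ cong (2 * pairSum s +_) (sum-cong-≗ (λ i → sym (bit*bit≡bit (s≤1 i)))) ⟩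
  2 * pairSum s + sum (λ i → s i * s i)  ≡⟨ sym (square-of-sum s) ⟩
  sum s * sum s                          ≡⟨ sym (2*nC2+n≡n*n (sum s)) ⟩
  2 * (sum s C 2) + sum s                ∎))
  where open ≡-Reasoning

b2n-∧ : ∀ x y → b2n (x ∧ y) ≡ b2n x * b2n y
b2n-∧ true  y = sym (*-identityˡ (b2n y))
b2n-∧ false y = refl

b2n-∧-weight-≤ : ∀ x y {s t} → s ≤ 1 → t ≤ 1 → b2n (x ∧ y) * (s + t) ≤ b2n (x ∧ y) + b2n x * (s * t)
b2n-∧-weight-≤ true  true  s≤1 t≤1 = subst₂ _≤_ (sym (*-identityˡ _)) (cong suc (sym (*-identityˡ _))) (bit+bit≤1+bit*bit s≤1 t≤1)
b2n-∧-weight-≤ true  false s≤1 t≤1 = z≤n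
b2n-∧-weight-≤ false y     s≤1 t≤1 = z≤n

module _ {n} (G : Graph n) where

  adjacent : Fin n → Fin n → ℕ
  adjacent i j = b2n (adj G i j)

  edge : Fin n → Fin n → ℕ
  edge i j = b2n ((toℕ i <ᵇ toℕ j) ∧ adj G i j)

  edge≡before*adjacent : ∀ i j → edge i j ≡ before i j * adjacent i j
  edge≡before*adjacent i j = b2n-∧ (toℕ i <ᵇ toℕ j) (adj G i j)

  δ*adjacent≡0 : ∀ i j → δ i j * adjacent i j ≡ 0
  δ*adjacent≡0 i j with i ≟ᶠ j
  ... | yes refl = cong (λ b → 1 * b2n b) (irrefl G i)
  ... | no  _    = refl

  adjacent≡edge+edge : ∀ i j → adjacent i j ≡ edge i j + edge j i
  adjacent≡edge+edge i j = begin
    adjacent i j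
      ≡⟨ sym (*-identityˡ (adjacent i j)) ⟩
    1 * adjacent i j
      ≡⟨ cong (_* adjacent i j) (sym (before-trichotomy i j)) ⟩
    (before i j + before j i + δ i j) * adjacent i j
      ≡⟨ distrib (before i j) (before j i) (δ i j) (adjacent i j) ⟩
    before i j * adjacent i j + before j i * adjacent i j + δ i j * adjacent i j
      ≡⟨ cong₂ _+_ (cong₂ _+_ (sym (edge≡before*adjacent i j))
                              (trans (cong (λ b → before j i * b2n b) (symm G i j)) (sym (edge≡before*adjacent j i))))
                   (δ*adjacent≡0 i j) ⟩
    edge i j + edge j i + 0
      ≡⟨ +-identityʳ _ ⟩
    edge i j + edge j i ∎
    where
    open ≡-Reasoning
    distrib : ∀ p q r x → (p + q + r) * x ≡ p * x + q * x + r * x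
    distrib = solve-∀

  weighted-degree : (s : Fin n → ℕ) →
                    sum (λ i → s i * degree G i) ≡ sum₂ (λ i j → edge i j * (s i + s j))
  weighted-degree s = begin
    sum (λ i → s i * degree G i)
      ≡⟨ sum-cong-≗ (λ i → *-distribˡ-sum (s i) (adjacent i)) ⟩
    sum₂ (λ i j → s i * adjacent i j)
      ≡⟨ sum₂-cong (λ i j → trans (cong (s i *_) (adjacent≡edge+edge i j)) (*-distribˡ-+ (s i) (edge i j) (edge j i))) ⟩
    sum₂ (λ i j → s i * edge i j + s i * edge j i)
      ≡⟨ sum₂-distrib-+ (λ i j → s i * edge i j) (λ i j → s i * edge j i) ⟩
    sum₂ (λ i j → s i * edge i j) + sum₂ (λ i j → s i * edge j i)
      ≡⟨ cong (sum₂ (λ i j → s i * edge i j) +_) (sum₂-transpose (λ i j → s j * edge i j)) ⟩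
    sum₂ (λ i j → s i * edge i j) + sum₂ (λ i j → s j * edge i j)
      ≡⟨ sym (sum₂-distrib-+ (λ i j → s i * edge i j) (λ i j → s j * edge i j)) ⟩
    sum₂ (λ i j → s i * edge i j + s j * edge i j)
      ≡⟨ sum₂-cong (λ i j → factor (s i) (s j) (edge i j)) ⟩
    sum₂ (λ i j → edge i j * (s i + s j)) ∎
    where
    open ≡-Reasoning
    factor : ∀ x y e → x * e + y * e ≡ e * (x + y)
    factor = solve-∀

  handshake : sum (degree G) ≡ 2 * edgeCount G
  handshake = begin
    sum (degree G)                         ≡⟨ sum-cong-≗ (λ i → sym (*-identityˡ (degree G i))) ⟩
    sum (λ i → 1 * degree G i)             ≡⟨ weighted-degree (λ _ → 1) ⟩
    sum₂ (λ i j → edge i j * 2)            ≡⟨ sum₂-cong (λ i j → *-comm (edge i j) 2) ⟩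
    sum₂ (λ i j → 2 * edge i j)            ≡⟨ sum-cong-≗ (λ i → sym (*-distribˡ-sum 2 (edge i))) ⟩
    sum (λ i → 2 * sum (edge i))           ≡⟨ sym (*-distribˡ-sum 2 (λ i → sum (edge i))) ⟩
    2 * edgeCount G                        ∎
    where open ≡-Reasoning

  -- An edge inside the support of s is counted twice on the left; there are at most
  -- (Σ s) choose 2 of them.
  weighted-degree-≤ : (s : Fin n → ℕ) → (∀ i → s i ≤ 1) →
                      sum (λ i → s i * degree G i) ≤ edgeCount G + sum s C 2
  weighted-degree-≤ s s≤1 = begin
    sum (λ i → s i * degree G i)
      ≡⟨ weighted-degree s ⟩
    sum₂ (λ i j → edge i j * (s i + s j))
      ≤⟨ sum₂-mono-≤ (λ i j → b2n-∧-weight-≤ (toℕ i <ᵇ toℕ j) (adj G i j) (s≤1 i) (s≤1 j)) ⟩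
    sum₂ (λ i j → edge i j + before i j * (s i * s j))
      ≡⟨ sum₂-distrib-+ edge (λ i j → before i j * (s i * s j)) ⟩
    edgeCount G + pairSum s
      ≡⟨ cong (edgeCount G +_) (pairSum-bits s s≤1) ⟩
    edgeCount G + sum s C 2 ∎
    where open ≤-Reasoning

  three-degrees-≤ : ∀ {a b c} → a ≢ b → a ≢ c → b ≢ c →
                    degree G a + degree G b + degree G c ≤ edgeCount G + 3
  three-degrees-≤ {a} {b} {c} a≢b a≢c b≢c = begin
    degree G a + degree G b + degree G c
      ≡⟨ sym (sum-δ₃ a b c (degree G)) ⟩
    sum (λ i → s i * degree G i)
      ≤⟨ weighted-degree-≤ s (δ+δ+δ≤1 a≢b a≢c b≢c) ⟩
    edgeCount G + sum s C 2
      ≡⟨ cong (λ k → edgeCount G + k C 2) |s|≡3 ⟩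
    edgeCount G + 3 ∎
    where
    open ≤-Reasoning
    s : Fin n → ℕ
    s i = δ a i + δ b i + δ c i
    |s|≡3 : sum s ≡ 3
    |s|≡3 = trans (sum-cong-≗ (λ i → sym (*-identityʳ (s i)))) (sum-δ₃ a b c (λ _ → 1))

  sum-degree-squares : sum (λ v → degree G v * degree G v) ≡ 2 * lineGraphEdges G + 2 * edgeCount G
  sum-degree-squares = begin
    sum (λ v → degree G v * degree G v)               ≡⟨ sum-cong-≗ (λ v → sym (2*nC2+n≡n*n (degree G v))) ⟩
    sum (λ v → 2 * (degree G v C 2) + degree G v)     ≡⟨ ∑-distrib-+ (λ v → 2 * (degree G v C 2)) (degree G) ⟩
    sum (λ v → 2 * (degree G v C 2)) + sum (degree G) ≡⟨ cong₂ _+_ (sym (*-distribˡ-sum 2 (λ v → degree G v C 2))) handshake ⟩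
    2 * lineGraphEdges G + 2 * edgeCount G            ∎
    where open ≡-Reasoning

degree-of-single-vertex : (G : Graph 1) → degree G zero ≡ 0
degree-of-single-vertex G = cong (λ b → b2n b + 0) (irrefl G zero)

argmax : ∀ {n} (f : Fin (suc n) → ℕ) → ∃[ b ] (∀ v → f v ≤ f b)
argmax {zero}  f = zero , λ { zero → ≤-refl }
argmax {suc n} f with argmax (f ∘ suc)
... | b , max with f zero ≤? f (suc b)
...   | yes f0≤fb = suc b , λ { zero → f0≤fb ; (suc v) → max v }
...   | no  f0≰fb = zero  , λ { zero → ≤-refl ; (suc v) → ≤-trans (max v) (≰⇒≥ f0≰fb) }

argmax-avoiding : ∀ {n} (f : Fin (suc (suc n)) → ℕ) (a : Fin (suc (suc n))) →
                  ∃[ b ] (a ≢ b × ∀ v → a ≢ v → f v ≤ f b)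
argmax-avoiding f a with argmax (f ∘ punchIn a)
... | i , max = punchIn a i , (λ a≡b → punchInᵢ≢i a i (sym a≡b)) ,
                λ v a≢v → subst (λ w → f w ≤ f (punchIn a i)) (punchIn-punchOut a≢v) (max (punchOut a≢v))

sum-squares-≤ : ∀ {n} (d : Fin n → ℕ) {a b : Fin n} {m x y} → a ≢ b → d a ≡ m + x → d b ≡ m + y →
                (∀ v → a ≢ v → b ≢ v → d v ≤ m) →
                sum (λ v → d v * d v) ≤ m * sum d + (x * d a + y * d b)
sum-squares-≤ d {a} {b} {m} {x} {y} a≢b da≡m+x db≡m+y d≤m = begin
  sum (λ v → d v * d v)
    ≤⟨ sum-mono-≤ square-≤ ⟩
  sum (λ v → m * d v + (δ a v * (x * d v) + δ b v * (y * d v)))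
    ≡⟨ ∑-distrib-+ (λ v → m * d v) (λ v → δ a v * (x * d v) + δ b v * (y * d v)) ⟩
  sum (λ v → m * d v) + sum (λ v → δ a v * (x * d v) + δ b v * (y * d v))
    ≡⟨ cong₂ _+_ (sym (*-distribˡ-sum m d))
                 (trans (∑-distrib-+ (λ v → δ a v * (x * d v)) (λ v → δ b v * (y * d v)))
                        (cong₂ _+_ (sum-δ a (λ v → x * d v)) (sum-δ b (λ v → y * d v)))) ⟩
  m * sum d + (x * d a + y * d b) ∎
  where
  open ≤-Reasoning
  at-a : ∀ m x y → (m + x) * (m + x) ≡ m * (m + x) + (1 * (x * (m + x)) + 0 * (y * (m + x)))
  at-a = solve-∀
  at-b : ∀ m x y → (m + y) * (m + y) ≡ m * (m + y) + (0 * (x * (m + y)) + 1 * (y * (m + y)))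
  at-b = solve-∀
  square-≤ : ∀ v → d v * d v ≤ m * d v + (δ a v * (x * d v) + δ b v * (y * d v))
  square-≤ v with a ≟ᶠ v | b ≟ᶠ v
  ... | yes refl | yes refl = contradiction refl a≢b
  ... | yes refl | no _     = ≤-reflexive (subst (λ k → k * k ≡ m * k + (1 * (x * k) + 0 * (y * k))) (sym da≡m+x) (at-a m x y))
  ... | no _     | yes refl = ≤-reflexive (subst (λ k → k * k ≡ m * k + (0 * (x * k) + 1 * (y * k))) (sym db≡m+y) (at-b m x y))
  ... | no a≢v   | no b≢v   = ≤-trans (*-monoˡ-≤ (d v) (d≤m v a≢v b≢v)) (m≤m+n (m * d v) 0)

≤-by-slack : ∀ {a b} c → a + c ≡ b → a ≤ b
≤-by-slack c refl = m≤m+n _ c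

bound-when-β-small : ∀ {N Δ β x q r} → Δ ≡ β + x → N ≡ 2 * Δ + q → Δ + β + β + r ≡ N + 3 →
                     3 * (β * (2 * N) + (x * Δ + 0 * β)) ≤ 2 * N * (N + 3)
bound-when-β-small {β = β} {x} {q} {r} refl refl total =
  subst (λ z → 3 * (β * (2 * N) + (x * (β + x) + 0 * β)) ≤ 2 * N * z) total
        (≤-by-slack (2 * N * r + x * (β + x + 2 * q)) (identity β x q r))
  where
  N : ℕ
  N = 2 * (β + x) + q
  identity : ∀ β x q r → let N = 2 * (β + x) + q in
             3 * (β * (2 * N) + (x * (β + x) + 0 * β)) + (2 * N * r + x * (β + x + 2 * q))
               ≡ 2 * N * ((β + x) + β + β + r)
  identity = solve-∀

bound-when-β-large : ∀ {N Δ β m x y t q} → x ≡ y + t → Δ ≡ m + x → β ≡ m + y → N ≡ 2 * Δ + q →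
                     m + (Δ + β) ≡ N + 3 → 3 * (m * (2 * N) + (x * Δ + y * β)) ≤ 2 * N * (N + 3)
bound-when-β-large {m = m} {y = y} {t} {q} refl refl refl refl total =
  subst Bound (sym m≡t+q+3)
        (≤-by-slack (8 * y * t + 2 * t * t + 6 * y * q + 3 * t * q + 6 * y + 3 * t + 2 * y * y) (identity y t q))
  where
  Bound : ℕ → Set
  Bound k = let N = 2 * (k + (y + t)) + q in
            3 * (k * (2 * N) + ((y + t) * (k + (y + t)) + y * (k + y))) ≤ 2 * N * (N + 3)
  regroupˡ : ∀ m y t → 2 * m + 2 * y + t + m ≡ m + ((m + (y + t)) + (m + y))
  regroupˡ = solve-∀
  regroupʳ : ∀ m y t q → 2 * (m + (y + t)) + q + 3 ≡ 2 * m + 2 * y + t + (t + q + 3)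
  regroupʳ = solve-∀
  m≡t+q+3 : m ≡ t + q + 3
  m≡t+q+3 = +-cancelˡ-≡ (2 * m + 2 * y + t) m (t + q + 3) (trans (regroupˡ m y t) (trans total (regroupʳ m y t q)))
  identity : ∀ y t q → let m = t + q + 3 ; N = 2 * (m + (y + t)) + q in
             3 * (m * (2 * N) + ((y + t) * (m + (y + t)) + y * (m + y)))
               + (8 * y * t + 2 * t * t + 6 * y * q + 3 * t * q + 6 * y + 3 * t + 2 * y * y)
               ≡ 2 * N * (N + 3)
  identity = solve-∀

module _ {n} (d : Fin n → ℕ) {N} {a b : Fin n} (a≢b : a ≢ b) (sum≡2N : sum d ≡ 2 * N)
         (2Δ≤N : 2 * d a ≤ N) (β≤Δ : d b ≤ d a) (b-second : ∀ v → a ≢ v → d v ≤ d b)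
         (three-≤ : ∀ v → a ≢ v → b ≢ v → d a + d b + d v ≤ N + 3) where

  -- Every vertex other than a and b has degree at most m := d b ⊓ (N + 3 ∸ (d a + d b)),
  -- by the choice of b and by three-≤; the two cases are m = d b and m + d a + d b = N + 3.
  private
    N≡2Δ+q : N ≡ 2 * d a + (N ∸ 2 * d a)
    N≡2Δ+q = sym (m+[n∸m]≡n 2Δ≤N)

    via-sum-squares-≤ : ∀ {m x y} → d a ≡ m + x → d b ≡ m + y → (∀ v → a ≢ v → b ≢ v → d v ≤ m) →
                        3 * (m * (2 * N) + (x * d a + y * d b)) ≤ 2 * N * (N + 3) →
                        3 * sum (λ v → d v * d v) ≤ 2 * N * (N + 3)
    via-sum-squares-≤ {m} {x} {y} da≡m+x db≡m+y d≤m bound =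
      ≤-trans (*-monoʳ-≤ 3 (sum-squares-≤ d a≢b da≡m+x db≡m+y d≤m))
              (subst (λ s → 3 * (m * s + (x * d a + y * d b)) ≤ 2 * N * (N + 3)) (sym sum≡2N) bound)

    when-β-small : d a + d b + d b ≤ N + 3 → 3 * sum (λ v → d v * d v) ≤ 2 * N * (N + 3)
    when-β-small small =
      via-sum-squares-≤ (sym (m+[n∸m]≡n β≤Δ)) (sym (+-identityʳ (d b))) (λ v a≢v _ → b-second v a≢v)
        (bound-when-β-small (sym (m+[n∸m]≡n β≤Δ)) N≡2Δ+q (m+[n∸m]≡n small))

    when-β-large : N + 3 < d a + d b + d b → 3 * sum (λ v → d v * d v) ≤ 2 * N * (N + 3)
    when-β-large large =
      via-sum-squares-≤ (sym (m+[n∸m]≡n m≤Δ)) (sym (m+[n∸m]≡n m≤β)) d≤m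
        (bound-when-β-large (sym (m+[n∸m]≡n (∸-monoˡ-≤ m β≤Δ))) (sym (m+[n∸m]≡n m≤Δ)) (sym (m+[n∸m]≡n m≤β))
                            N≡2Δ+q (m∸n+n≡m Δ+β≤N+3))
      where
      m : ℕ
      m = N + 3 ∸ (d a + d b)
      m≤β : m ≤ d b
      m≤β = m≤n+o⇒m∸n≤o (N + 3) (d a + d b) (<⇒≤ large)
      m≤Δ : m ≤ d a
      m≤Δ = ≤-trans m≤β β≤Δ
      Δ+β≤N+3 : d a + d b ≤ N + 3
      Δ+β≤N+3 = ≤-trans (+-monoʳ-≤ (d a) (≤-trans β≤Δ (m≤m+n (d a) 0))) (≤-trans 2Δ≤N (m≤m+n N 3))
      d≤m : ∀ v → a ≢ v → b ≢ v → d v ≤ m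
      d≤m v a≢v b≢v = m+n≤o⇒m≤o∸n (d v) (subst (_≤ N + 3) (+-comm (d a + d b) (d v)) (three-≤ v a≢v b≢v))

  sum-squares-bound : 3 * sum (λ v → d v * d v) ≤ 2 * N * (N + 3)
  sum-squares-bound with d a + d b + d b ≤? N + 3
  ... | yes small = when-β-small small
  ... | no  large = when-β-large (≰⇒> large)

3[2L+2N]≤2N[N+3]⇒3L≤N*N : ∀ L N → 3 * (2 * L + 2 * N) ≤ 2 * N * (N + 3) → 3 * L ≤ N * N
3[2L+2N]≤2N[N+3]⇒3L≤N*N L N h = *-cancelˡ-≤ 2 (+-cancelʳ-≤ (6 * N) (2 * (3 * L)) (2 * (N * N)) (subst₂ _≤_ (lhs L N) (rhs N) h))
  where
  lhs : ∀ L N → 3 * (2 * L + 2 * N) ≡ 2 * (3 * L) + 6 * N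
  lhs = solve-∀
  rhs : ∀ N → 2 * N * (N + 3) ≡ 2 * (N * N) + 6 * N
  rhs = solve-∀

mainTheorem15 : (N Δ : ℕ) → 12 ≤ N → 1 ≤ Δ → 2 * Δ ≤ N →
    (n : ℕ) (G : Graph n) → edgeCount G ≡ N → MaxDegreeIs G Δ → MinDegreeAtLeast1 G →
    3 * lineGraphEdges G ≤ N * N
mainTheorem15 _ _ _ _ _ zero _ _ (_ , () , _) _
mainTheorem15 _ _ _ 1≤Δ _ 1 G _ (_ , zero , d≡Δ) _ =
  contradiction (subst (1 ≤_) (trans (sym d≡Δ) (degree-of-single-vertex G)) 1≤Δ) λ ()
mainTheorem15 _ _ _ _ 2Δ≤N (suc (suc k)) G refl (d≤Δ , a , refl) _ =
  3[2L+2N]≤2N[N+3]⇒3L≤N*N (lineGraphEdges G) (edgeCount G)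
    (subst (λ s → 3 * s ≤ 2 * edgeCount G * (edgeCount G + 3)) (sum-degree-squares G)
      (sum-squares-bound (degree G) a≢b (handshake G) 2Δ≤N (d≤Δ b) b-second
        (λ v a≢v b≢v → three-degrees-≤ G a≢b a≢v b≢v)))
  where
  b : Fin (suc (suc k))
  b = proj₁ (argmax-avoiding (degree G) a)
  a≢b : a ≢ b
  a≢b = proj₁ (proj₂ (argmax-avoiding (degree G) a))
  b-second : ∀ v → a ≢ v → degree G v ≤ degree G b
  b-second = proj₂ (proj₂ (argmax-avoiding (degree G) a))
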